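{- Let $w\in S_n$ with Rothe diagram $D(w)$ and columns $D_j=\{i:(i,j)\in D(w)\}$. The following are equivalent: (1) the movable intervals $M(D_1),\ldots,M(D_n)$ are pairwise disjoint; (2) $w$ avoids the permutation patterns $1423$, $1432$, $13254$; (3) for every $i\in[n]$, there is at most one column index $c$ such that $D(w)$ contains a box $(r,c)$ with $r>i$ and $c>w(i)$ (i.e. at most one column contains boxes of $D(w)$ in the region to the lower right of the hook with corner $(i,w(i))$).
   Context: Rothe diagram: $D(w)=\{(i,j)\in[n]^2:w(i)>j,\ w^{ -1}(j)>i\}$; box $(i,j)$ is in row $i$ from the top and column $j$ from the left. The hook with corner $(i,w(i))$ is the union of the rightward and downward rays from that point. For $a\le b$, $[a,b]=\{a,\ldots,b\}$. Movable interval of $D_j\subseteq[n]$: if $D_j\ne\emptyset$ and $D_j\ne[n]$, let $a=\min([n]\setminus D_j)$, $b=\max D_j$, and $M(D_j)=[a,b]$ if $a<b$; otherwise $M(D_j)=\emptyset$. Pattern avoidance: $w$ contains $\tau\in S_k$ if some subsequence $w(i_1),\ldots,w(i_k)$ with $i_1<\cdots<i_k$ is order-isomorphic to $\tau$; otherwise it avoids $\tau$. -}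

module Defs where

open import Data.Nat using (ℕ; zero; suc)
import Data.Nat as ℕ
open import Data.Fin using (Fin; zero; suc; _<_; _≤_; _<?_)
open import Data.Fin.Permutation using (Permutation′; _⟨$⟩ʳ_; _⟨$⟩ˡ_)
open import Data.Bool using (Bool; true; false; if_then_else_)
open import Data.Maybe using (Maybe; just; nothing)
import Data.Maybe as Maybe
open import Data.Vec using (Vec; lookup; []; _∷_)
open import Data.Product using (Σ; _×_; ∃; ∃-syntax; _,_)
open import Function using (_∘_)
open import Function.Bundles using (_⇔_)
open import Relation.Nullary using (¬_)
open import Relation.Nullary.Decidable using (⌊_⌋; _×-dec_)
open import Relation.Binary.PropositionalEquality using (_≡_; _≢_)

-- Indices are 0-based: Fin n stands for [n] = {1,…,n} shifted by one.
-- A permutation w ∈ S_n; w(i) = w ⟨$⟩ʳ i, w⁻¹(j) = w ⟨$⟩ˡ j.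

InRothe : ∀ {n} → Permutation′ n → Fin n → Fin n → Set
InRothe w i j = (j < w ⟨$⟩ʳ i) × (i < w ⟨$⟩ˡ j)

column : ∀ {n} → Permutation′ n → Fin n → (Fin n → Bool)
column w j i = ⌊ (j <? w ⟨$⟩ʳ i) ×-dec (i <? w ⟨$⟩ˡ j) ⌋

firstTrue : ∀ {n} → (Fin n → Bool) → Maybe (Fin n)
firstTrue {zero} p = nothing
firstTrue {suc n} p = if p zero then just zero else Maybe.map suc (firstTrue (p ∘ suc))

lastTrue : ∀ {n} → (Fin n → Bool) → Maybe (Fin n)
lastTrue {zero} p = nothing
lastTrue {suc n} p with lastTrue (p ∘ suc)
... | just k = just (suc k)
... | nothing = if p zero then just zero else nothing

not∘ : ∀ {n} → (Fin n → Bool) → (Fin n → Bool)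
not∘ p x = Data.Bool.not (p x)

-- Membership in the movable interval M(D) of D ⊆ [n]:
-- D ≠ ∅ (b = max D exists), D ≠ [n] (a = min([n]∖D) exists), a < b, and a ≤ x ≤ b.
-- (If any of these fails, M(D) = ∅.)
InMovable : ∀ {n} → (Fin n → Bool) → Fin n → Set
InMovable {n} D x =
  Σ (Fin n) λ a → Σ (Fin n) λ b →
    (firstTrue (not∘ D) ≡ just a) × (lastTrue D ≡ just b) × (a < b) × (a ≤ x) × (x ≤ b)

MovableDisjoint : ∀ {n} → Permutation′ n → Set
MovableDisjoint {n} w = ∀ (j j' : Fin n) → j ≢ j' → ∀ (x : Fin n) →
  ¬ (InMovable (column w j) x × InMovable (column w j') x)

-- Pattern containment: τ given by its one-line notation (a list of k values,
-- only relative order matters).  w contains τ iff there are positions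
-- i₁ < … < i_k with w(i_a) < w(i_b) ⇔ τ(a) < τ(b).
Contains : ∀ {n k} → Permutation′ n → Vec ℕ k → Set
Contains {n} {k} w τ = Σ (Fin k → Fin n) λ f →
  (∀ a b → a < b → f a < f b) ×
  (∀ a b → (w ⟨$⟩ʳ f a < w ⟨$⟩ʳ f b) ⇔ (lookup τ a ℕ.< lookup τ b))

Avoids : ∀ {n k} → Permutation′ n → Vec ℕ k → Set
Avoids w τ = ¬ Contains w τ

p1423 : Vec ℕ 4
p1423 = 1 ∷ 4 ∷ 2 ∷ 3 ∷ []

p1432 : Vec ℕ 4
p1432 = 1 ∷ 4 ∷ 3 ∷ 2 ∷ []

p13254 : Vec ℕ 5
p13254 = 1 ∷ 3 ∷ 2 ∷ 5 ∷ 4 ∷ []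

AvoidsPatterns : ∀ {n} → Permutation′ n → Set
AvoidsPatterns w = Avoids w p1423 × Avoids w p1432 × Avoids w p13254

LowerRightColumn : ∀ {n} → Permutation′ n → Fin n → Fin n → Set
LowerRightColumn w i c = (w ⟨$⟩ʳ i < c) × ∃[ r ] (i < r × InRothe w r c)

HookCondition : ∀ {n} → Permutation′ n → Set
HookCondition {n} w = ∀ (i : Fin n) → ∀ (c c' : Fin n) →
  LowerRightColumn w i c → LowerRightColumn w i c' → c ≡ c'

module Submission where

-- Column c lies to the lower right of the hook at row i iff (i, r, w⁻¹(c)) is an occurrence of 132
-- for some r, and then i lies in the movable interval M(D_c).  Conversely the top end a of M(D_c)
-- always has c to the lower right of its hook, and when M(D_c) and M(D_c') share a row, the lower
-- of their two top ends has both columns to the lower right of its hook.  So (3) says that all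
-- 132-occurrences starting at i end at the same position; two occurrences (i, r, s), (i, r', s')
-- with s < s' always combine into 1423, 1432 or 13254, while each of these patterns contains two
-- such occurrences with a common first entry.

open import Defs
open import Data.Nat using (ℕ; zero; suc; z≤n; s≤s; s<s⁻¹)
import Data.Nat as ℕ
import Data.Nat.Properties as ℕP
open import Data.Fin using (Fin; zero; suc; toℕ; _<_; _≤_; _≟_; _<?_; #_)
open import Data.Fin.Properties using (<-cmp; <-irrefl; <-asym; <-trans; ≤∧≢⇒<; <⇒≢)
open import Data.Fin.Permutation using (Permutation′; _⟨$⟩ʳ_; _⟨$⟩ˡ_; inverseˡ; inverseʳ)
open import Data.Bool using (Bool; true; false; not)
open import Data.Bool.Properties using (not-injective)
open import Data.Maybe using (just; nothing)
open import Data.Vec using (Vec; []; _∷_; lookup; map)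
open import Data.Vec.Properties using (lookup-map)
open import Data.Vec.Relation.Unary.Linked using (Linked; []; [-]; _∷_)
open import Data.Vec.Relation.Unary.Linked.Properties using (lookup⁺)
open import Data.Product using (_×_; ∃-syntax; _,_; proj₁; proj₂)
open import Data.Sum using (_⊎_; inj₁; inj₂; [_,_]′)
open import Data.Empty using (⊥-elim)
open import Function using (_∘_; _on_)
open import Function.Bundles using (_⇔_; mk⇔; Equivalence)
import Function.Properties.Equivalence as ⇔
open import Relation.Nullary using (¬_; Dec; yes; no)
open import Relation.Nullary.Decidable using (True; toWitness; ⌊_⌋; _×-dec_)
open import Relation.Binary using (tri<; tri≈; tri>)
open import Relation.Binary.PropositionalEquality using (_≡_; _≢_; refl; sym; trans; cong; subst; subst₂)

⌊⌋≡true⇔ : ∀ {A : Set} (a? : Dec A) → ⌊ a? ⌋ ≡ true ⇔ A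
⌊⌋≡true⇔ (yes a)  = mk⇔ (λ _ → a) (λ _ → refl)
⌊⌋≡true⇔ (no ¬a)  = mk⇔ (λ ()) (⊥-elim ∘ ¬a)

⌊⌋≡false⇔ : ∀ {A : Set} (a? : Dec A) → ⌊ a? ⌋ ≡ false ⇔ (¬ A)
⌊⌋≡false⇔ (yes a) = mk⇔ (λ ()) (λ ¬a → ⊥-elim (¬a a))
⌊⌋≡false⇔ (no ¬a) = mk⇔ (λ _ → ¬a) (λ _ → refl)

firstTrue-just : ∀ {n} (p : Fin n → Bool) {a} → firstTrue p ≡ just a →
                 p a ≡ true × (∀ y → y < a → p y ≡ false)
firstTrue-just {suc n} p eq with p zero in p0 | firstTrue (p ∘ suc) in first
firstTrue-just {suc n} p refl | true  | _      = p0 , λ _ ()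
firstTrue-just {suc n} p refl | false | just k = proj₁ below , earlier
  where
  below : p (suc k) ≡ true × (∀ y → y < k → p (suc y) ≡ false)
  below = firstTrue-just (p ∘ suc) first
  earlier : ∀ y → y < suc k → p y ≡ false
  earlier zero    _         = p0
  earlier (suc y) (s≤s y<k) = proj₂ below y y<k

firstTrue-≤ : ∀ {n} (p : Fin n → Bool) {x} → p x ≡ true →
              ∃[ a ] firstTrue p ≡ just a × a ≤ x
firstTrue-≤ {suc n} p px with p zero in p0
... | true = zero , refl , z≤n
firstTrue-≤ {suc n} p {zero} px | false with () ← trans (sym px) p0
firstTrue-≤ {suc n} p {suc x} px | false with firstTrue-≤ (p ∘ suc) px
... | a , first , a≤x rewrite first = suc a , refl , s≤s a≤x

lastTrue-just : ∀ {n} (p : Fin n → Bool) {b} → lastTrue p ≡ just b → p b ≡ true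
lastTrue-just {suc n} p eq with lastTrue (p ∘ suc) in last
lastTrue-just {suc n} p refl | just k = lastTrue-just (p ∘ suc) last
... | nothing with p zero in p0
lastTrue-just {suc n} p refl | nothing | true = p0

lastTrue-≥ : ∀ {n} (p : Fin n → Bool) {x} → p x ≡ true →
             ∃[ b ] lastTrue p ≡ just b × x ≤ b
lastTrue-≥ {suc n} p {zero} px with lastTrue (p ∘ suc)
... | just k  = suc k , refl , z≤n
... | nothing rewrite px = zero , refl , z≤n
lastTrue-≥ {suc n} p {suc x} px with lastTrue-≥ (p ∘ suc) px
... | b , last , x≤b rewrite last = suc b , refl , s≤s x≤b

increasing⇒injective : ∀ {k m} {f : Fin k → Fin m} → (∀ a b → a < b → f a < f b) →
                       ∀ {a b} → f a ≡ f b → a ≡ b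
increasing⇒injective inc {a} {b} fa≡fb with <-cmp a b
... | tri< a<b _ _ = ⊥-elim (<⇒≢ (inc a b a<b) fa≡fb)
... | tri≈ _ a≡b _ = a≡b
... | tri> _ _ b<a = ⊥-elim (<⇒≢ (inc b a b<a) (sym fa≡fb))

Sub132 : ∀ {k} → Vec ℕ k → Fin k → Fin k → Fin k → Set
Sub132 τ a b c = a < b × b < c × lookup τ a ℕ.< lookup τ c × lookup τ c ℕ.< lookup τ b

sub132? : ∀ {k} (τ : Vec ℕ k) a b c → Dec (Sub132 τ a b c)
sub132? τ a b c =
  (a <? b) ×-dec (b <? c) ×-dec (lookup τ a ℕ.<? lookup τ c) ×-dec (lookup τ c ℕ.<? lookup τ b)

sub132 : ∀ {k} (τ : Vec ℕ k) a b c → {True (sub132? τ a b c)} → Sub132 τ a b c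
sub132 τ a b c {isSub132} = toWitness isSub132

module _ {n : ℕ} (w : Permutation′ n) where

  w[_] w⁻¹[_] : Fin n → Fin n
  w[ i ]   = w ⟨$⟩ʳ i
  w⁻¹[ j ] = w ⟨$⟩ˡ j

  w-injective : ∀ {i i'} → w[ i ] ≡ w[ i' ] → i ≡ i'
  w-injective {i} {i'} e = trans (sym (inverseˡ w)) (trans (cong w⁻¹[_] e) (inverseˡ w))

  w⁻¹-injective : ∀ {j j'} → w⁻¹[ j ] ≡ w⁻¹[ j' ] → j ≡ j'
  w⁻¹-injective {j} {j'} e = trans (sym (inverseʳ w)) (trans (cong w[_] e) (inverseʳ w))

  inRothe? : ∀ i j → Dec (InRothe w i j)
  inRothe? i j = (j <? w[ i ]) ×-dec (i <? w⁻¹[ j ])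

  column≡true⇔ : ∀ {i j} → column w j i ≡ true ⇔ InRothe w i j
  column≡true⇔ {i} {j} = ⌊⌋≡true⇔ (inRothe? i j)

  column≡false⇔ : ∀ {i j} → column w j i ≡ false ⇔ (¬ InRothe w i j)
  column≡false⇔ {i} {j} = ⌊⌋≡false⇔ (inRothe? i j)

  Occurs132 : Fin n → Fin n → Fin n → Set
  Occurs132 i r s = i < r × r < s × w[ i ] < w[ s ] × w[ s ] < w[ r ]

  lowerRightColumn⇔132 : ∀ {i s} → LowerRightColumn w i w[ s ] ⇔ (∃[ r ] Occurs132 i r s)
  lowerRightColumn⇔132 {i} {s} = mk⇔ to from
    where
    to : LowerRightColumn w i w[ s ] → ∃[ r ] Occurs132 i r s
    to (wi<ws , r , i<r , ws<wr , r<s) = r , i<r , subst (r <_) (inverseˡ w) r<s , wi<ws , ws<wr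
    from : ∃[ r ] Occurs132 i r s → LowerRightColumn w i w[ s ]
    from (r , i<r , r<s , wi<ws , ws<wr) = wi<ws , r , i<r , ws<wr , subst (r <_) (sym (inverseˡ w)) r<s

  Unique132 : Set
  Unique132 = ∀ {i r s r' s'} → Occurs132 i r s → Occurs132 i r' s' → s ≡ s'

  hook⇔unique132 : HookCondition w ⇔ Unique132
  hook⇔unique132 = mk⇔ to from
    where
    to : HookCondition w → Unique132
    to H occ occ' = w-injective (H _ _ _ (Equivalence.from lowerRightColumn⇔132 (_ , occ))
                                        (Equivalence.from lowerRightColumn⇔132 (_ , occ')))
    occurs : ∀ {i c} → LowerRightColumn w i c → ∃[ r ] Occurs132 i r w⁻¹[ c ]
    occurs {i} = Equivalence.to lowerRightColumn⇔132 ∘ subst (LowerRightColumn w i) (sym (inverseʳ w))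
    from : Unique132 → HookCondition w
    from U i c c' L L' = w⁻¹-injective (U (proj₂ (occurs L)) (proj₂ (occurs L')))

  record MovableEnds (c x : Fin n) : Set where
    field
      left right : Fin n
      left-hook  : LowerRightColumn w left c
      above-left : ∀ y → y < left → InRothe w y c
      right-box  : InRothe w right c
      left≤x     : left ≤ x
      x≤right    : x ≤ right
  open MovableEnds

  inMovable⇒ends : ∀ {c x} → InMovable (column w c) x → MovableEnds c x
  inMovable⇒ends {c} (a , b , first , last , a<b , a≤x , x≤b) = record
    { left       = a
    ; right      = b
    ; left-hook  = w[a]<c , b , a<b , b∈
    ; above-left = λ y y<a → Equivalence.to column≡true⇔ (not-injective (proj₂ first-a y y<a))
    ; right-box  = b∈
    ; left≤x     = a≤x
    ; x≤right    = x≤b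
    }
    where
    first-a : not (column w c a) ≡ true × (∀ y → y < a → not (column w c y) ≡ false)
    first-a = firstTrue-just (not∘ (column w c)) first
    b∈ : InRothe w b c
    b∈ = Equivalence.to column≡true⇔ (lastTrue-just (column w c) last)
    a<w⁻¹c : a < w⁻¹[ c ]
    a<w⁻¹c = <-trans a<b (proj₂ b∈)
    w[a]≢c : w[ a ] ≢ c
    w[a]≢c e = <-irrefl (trans (sym (inverseˡ w)) (cong w⁻¹[_] e)) a<w⁻¹c
    a∉ : ¬ InRothe w a c
    a∉ = Equivalence.to column≡false⇔ (not-injective (proj₁ first-a))
    w[a]<c : w[ a ] < c
    w[a]<c = ≤∧≢⇒< (ℕP.≮⇒≥ λ c<w[a] → a∉ (c<w[a] , a<w⁻¹c)) w[a]≢c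

  lowerRight⇒inMovable : ∀ {i c} → LowerRightColumn w i c → InMovable (column w c) i
  lowerRight⇒inMovable {i} {c} (w[i]<c , r , i<r , r∈)
    with firstTrue-≤ (not∘ (column w c)) i∉ | lastTrue-≥ (column w c) (Equivalence.from column≡true⇔ r∈)
    where
    i∉ : not (column w c i) ≡ true
    i∉ = cong not (Equivalence.from column≡false⇔ λ i∈ → <-asym (proj₁ i∈) w[i]<c)
  ... | a , first , a≤i | b , last , r≤b =
    a , b , first , last , ℕP.≤-<-trans a≤i (ℕP.<-≤-trans i<r r≤b) ,
    a≤i , ℕP.≤-trans (ℕP.<⇒≤ i<r) r≤b

  lowerRight-intro : ∀ {a b c} → w[ a ] < c → InRothe w b c → a ≤ b → LowerRightColumn w a c
  lowerRight-intro {a} {b} w[a]<c b∈ a≤b = w[a]<c , b , ≤∧≢⇒< a≤b a≢b , b∈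
    where
    a≢b : a ≢ b
    a≢b refl = <-asym w[a]<c (proj₁ b∈)

  -- row left E lies above left E', so it is in column c', whence w(left E') < c' < w(left E) < c
  sameColumn-if-left< : HookCondition w → ∀ {c c' x} (E : MovableEnds c x) (E' : MovableEnds c' x) →
                        left E < left E' → c ≡ c'
  sameColumn-if-left< H {c} {c'} E E' a<a' = H (left E') c c' hook-c (left-hook E')
    where
    w[a']<c : w[ left E' ] < c
    w[a']<c = <-trans (proj₁ (left-hook E')) (<-trans (proj₁ (above-left E' (left E) a<a')) (proj₁ (left-hook E)))
    hook-c : LowerRightColumn w (left E') c
    hook-c = lowerRight-intro w[a']<c (right-box E) (ℕP.≤-trans (left≤x E') (x≤right E))

  hook⇒movableDisjoint : HookCondition w → MovableDisjoint w
  hook⇒movableDisjoint H c c' c≢c' x (m , m') with E ← inMovable⇒ends m | E' ← inMovable⇒ends m'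
    with <-cmp (left E) (left E')
  ... | tri< a<a' _ _ = c≢c' (sameColumn-if-left< H E E' a<a')
  ... | tri> _ _ a'<a = c≢c' (sym (sameColumn-if-left< H E' E a'<a))
  ... | tri≈ _ a≡a' _ =
    c≢c' (H _ c c' (left-hook E) (subst (λ a → LowerRightColumn w a c') (sym a≡a') (left-hook E')))

  movableDisjoint⇒hook : MovableDisjoint w → HookCondition w
  movableDisjoint⇒hook M i c c' L L' with c ≟ c'
  ... | yes c≡c' = c≡c'
  ... | no  c≢c' = ⊥-elim (M c c' c≢c' i (lowerRight⇒inMovable L , lowerRight⇒inMovable L'))

  -- hs lists the positions of an occurrence by increasing value, and ρ a is the rank of entry a
  contains-byRank : ∀ {k} (ρ : Vec (Fin k) k) (hs : Vec (Fin n) k) →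
                    Linked (_<_ on w[_]) hs → Linked _<_ (map (lookup hs) ρ) →
                    Contains w (map (suc ∘ toℕ) ρ)
  contains-byRank {k} ρ hs values↗ positions↗ = f , increasing , orderIso
    where
    f : Fin k → Fin n
    f a = lookup hs (lookup ρ a)
    increasing : ∀ a b → a < b → f a < f b
    increasing a b a<b =
      subst₂ _<_ (lookup-map a (lookup hs) ρ) (lookup-map b (lookup hs) ρ) (lookup⁺ <-trans positions↗ a<b)
    value-<⁻¹ : ∀ {i j} → w[ lookup hs i ] < w[ lookup hs j ] → i < j
    value-<⁻¹ {i} {j} lt with <-cmp i j
    ... | tri< i<j _ _ = i<j
    ... | tri≈ _ refl _ = ⊥-elim (<-irrefl refl lt)
    ... | tri> _ _ j<i = ⊥-elim (<-asym lt (lookup⁺ <-trans values↗ j<i))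
    rank : ∀ a → lookup (map (suc ∘ toℕ) ρ) a ≡ suc (toℕ (lookup ρ a))
    rank a = lookup-map a (suc ∘ toℕ) ρ
    orderIso : ∀ a b →
               (w[ f a ] < w[ f b ]) ⇔ (lookup (map (suc ∘ toℕ) ρ) a ℕ.< lookup (map (suc ∘ toℕ) ρ) b)
    orderIso a b = mk⇔
      (λ lt → subst₂ ℕ._<_ (sym (rank a)) (sym (rank b)) (s≤s (value-<⁻¹ lt)))
      (λ lt → lookup⁺ <-trans values↗ (s<s⁻¹ (subst₂ ℕ._<_ (rank a) (rank b) lt)))

  two132⇒pattern : ∀ {i r s r' s'} → Occurs132 i r s → Occurs132 i r' s' → s < s' →
                   Contains w p1423 ⊎ Contains w p1432 ⊎ Contains w p13254
  two132⇒pattern {i} {r} {s} {r'} {s'} (i<r , r<s , wi<ws , ws<wr) (i<r' , r'<s' , wi<ws' , ws'<wr') s<s'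
    with <-cmp w[ s ] w[ s' ]
  ... | tri> _ _ ws'<ws = inj₂ (inj₁
          (contains-byRank (# 0 ∷ # 3 ∷ # 2 ∷ # 1 ∷ []) (i ∷ s' ∷ s ∷ r ∷ [])
            (wi<ws' ∷ ws'<ws ∷ ws<wr ∷ [-]) (i<r ∷ r<s ∷ s<s' ∷ [-])))
  ... | tri≈ _ ws≡ws' _ = ⊥-elim (<⇒≢ s<s' (w-injective ws≡ws'))
  ... | tri< ws<ws' _ _ with <-cmp r' s
  ...   | tri< r'<s _ _ = inj₁
          (contains-byRank (# 0 ∷ # 3 ∷ # 1 ∷ # 2 ∷ []) (i ∷ s ∷ s' ∷ r' ∷ [])
            (wi<ws ∷ ws<ws' ∷ ws'<wr' ∷ [-]) (i<r' ∷ r'<s ∷ s<s' ∷ [-]))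
  ...   | tri≈ _ refl _ = ⊥-elim (<-asym ws<ws' ws'<wr')
  ...   | tri> _ _ s<r' with <-cmp w[ r ] w[ s' ]
  ...     | tri< wr<ws' _ _ = inj₂ (inj₂
            (contains-byRank (# 0 ∷ # 2 ∷ # 1 ∷ # 4 ∷ # 3 ∷ []) (i ∷ s ∷ r ∷ s' ∷ r' ∷ [])
              (wi<ws ∷ ws<wr ∷ wr<ws' ∷ ws'<wr' ∷ [-]) (i<r ∷ r<s ∷ s<r' ∷ r'<s' ∷ [-])))
  ...     | tri≈ _ wr≡ws' _ = ⊥-elim (<⇒≢ (<-trans r<s s<s') (w-injective wr≡ws'))
  ...     | tri> _ _ ws'<wr = inj₁
            (contains-byRank (# 0 ∷ # 3 ∷ # 1 ∷ # 2 ∷ []) (i ∷ s ∷ s' ∷ r ∷ [])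
              (wi<ws ∷ ws<ws' ∷ ws'<wr ∷ [-]) (i<r ∷ r<s ∷ s<s' ∷ [-]))

  avoidsPatterns⇒¬contains : AvoidsPatterns w → ¬ (Contains w p1423 ⊎ Contains w p1432 ⊎ Contains w p13254)
  avoidsPatterns⇒¬contains (a1423 , a1432 , a13254) = [ a1423 , [ a1432 , a13254 ]′ ]′

  avoidsPatterns⇒unique132 : AvoidsPatterns w → Unique132
  avoidsPatterns⇒unique132 A {s = s} {s' = s'} occ occ' with <-cmp s s'
  ... | tri< s<s' _ _ = ⊥-elim (avoidsPatterns⇒¬contains A (two132⇒pattern occ occ' s<s'))
  ... | tri≈ _ s≡s' _ = s≡s'
  ... | tri> _ _ s'<s = ⊥-elim (avoidsPatterns⇒¬contains A (two132⇒pattern occ' occ s'<s))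

  occurs132-ofSub132 : ∀ {k} (τ : Vec ℕ k) ((f , _) : Contains w τ) → ∀ {a b c} → Sub132 τ a b c →
                       Occurs132 (f a) (f b) (f c)
  occurs132-ofSub132 τ (f , increasing , orderIso) {a} {b} {c} (a<b , b<c , τa<τc , τc<τb) =
    increasing a b a<b , increasing b c b<c ,
    Equivalence.from (orderIso a c) τa<τc , Equivalence.from (orderIso c b) τc<τb

  unique132⇒avoids : Unique132 → ∀ {k} (τ : Vec ℕ k) {a b c b' c'} →
                     Sub132 τ a b c → Sub132 τ a b' c' → c ≢ c' → Avoids w τ
  unique132⇒avoids U τ sub sub' c≢c' C@(_ , increasing , _) =
    c≢c' (increasing⇒injective increasing (U (occurs132-ofSub132 τ C sub) (occurs132-ofSub132 τ C sub')))

  unique132⇒avoidsPatterns : Unique132 → AvoidsPatterns w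
  unique132⇒avoidsPatterns U =
    unique132⇒avoids U p1423 (sub132 p1423 (# 0) (# 1) (# 2)) (sub132 p1423 (# 0) (# 1) (# 3)) (λ ()) ,
    unique132⇒avoids U p1432 (sub132 p1432 (# 0) (# 1) (# 2)) (sub132 p1432 (# 0) (# 1) (# 3)) (λ ()) ,
    unique132⇒avoids U p13254 (sub132 p13254 (# 0) (# 1) (# 2)) (sub132 p13254 (# 0) (# 3) (# 4)) (λ ())

proposition5p2 : ∀ (n : ℕ) (w : Permutation′ n) →
    (MovableDisjoint w ⇔ AvoidsPatterns w) × (AvoidsPatterns w ⇔ HookCondition w)
proposition5p2 n w = ⇔.trans movable⇔hook hook⇔avoids , ⇔.sym hook⇔avoids
  where
  movable⇔hook : MovableDisjoint w ⇔ HookCondition w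
  movable⇔hook = mk⇔ (movableDisjoint⇒hook w) (hook⇒movableDisjoint w)
  avoids⇔unique132 : AvoidsPatterns w ⇔ Unique132 w
  avoids⇔unique132 = mk⇔ (avoidsPatterns⇒unique132 w) (unique132⇒avoidsPatterns w)
  hook⇔avoids : HookCondition w ⇔ AvoidsPatterns w
  hook⇔avoids = ⇔.trans (hook⇔unique132 w) (⇔.sym avoids⇔unique132)
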